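{- Let $n\ge1$ and $w\in S_n$. There is no homing shuffle $F:S_n\to S_n$ that sorts $w$ if and only if $w\in U_n$.
   Context: $[n]=\{1,\dots,n\}$, $S_n$ is the group of bijections $[n]\to[n]$ with product $(ab)(i)=a(b(i))$, and $\varepsilon$ is its identity. A homing shuffle is a map $F:S_n\to S_n$ such that for every $w\in S_n$, setting $k:=w(1)$: (a) $F(w)(k)=k$, and (b) $F(w)(i)=w(i)$ for all $i>k$. $F$ sorts $w$ if $F^m(w)=\varepsilon$ for some $m\in\mathbb{N}$, where $F^m$ is the $m$-th iterate. For $w\in S_n$, $i_w$ is the smallest $k\in[n]$ with $w([k])=[k]$. $U_n:=\{w\in S_n : \text{there is } i>i_w \text{ with } w(i)\neq i\}$. -}

module Defs where

open import Data.Nat using (ℕ; zero; suc; _<_; _≤_)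
open import Data.Fin using (Fin; toℕ)
open import Data.Fin.Permutation using (Permutation′; _⟨$⟩ʳ_)
open import Data.Product using (Σ; ∃; _×_; _,_)
open import Relation.Binary.PropositionalEquality using (_≡_; _≢_)
open import Relation.Nullary using (¬_)

-- Elements of S_n are permutations of Fin n; the position i ∈ [n] is the
-- element of Fin n with toℕ = i - 1 (so "1" is Fin.zero, "i ≤ k" is toℕ i < k).

_≋_ : ∀ {n} → Permutation′ n → Permutation′ n → Set
π ≋ ρ = ∀ i → π ⟨$⟩ʳ i ≡ ρ ⟨$⟩ʳ i

IsIdentity : ∀ {n} → Permutation′ n → Set
IsIdentity π = ∀ i → π ⟨$⟩ʳ i ≡ i

iter : ∀ {A : Set} → (A → A) → ℕ → A → A
iter f zero    x = x
iter f (suc m) x = f (iter f m x)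

WellDefined : ∀ {n} → (Permutation′ n → Permutation′ n) → Set
WellDefined F = ∀ π ρ → π ≋ ρ → F π ≋ F ρ

IsHoming : ∀ {m} → (Permutation′ (suc m) → Permutation′ (suc m)) → Set
IsHoming F = WellDefined F ×
  (∀ w → let k = w ⟨$⟩ʳ Fin.zero in
     (F w ⟨$⟩ʳ k ≡ k) ×
     (∀ i → toℕ k < toℕ i → F w ⟨$⟩ʳ i ≡ w ⟨$⟩ʳ i))
  where import Data.Fin as Fin

Sorts : ∀ {n} → (Permutation′ n → Permutation′ n) → Permutation′ n → Set
Sorts F w = ∃ λ m → IsIdentity (iter F m w)

FixesInitial : ∀ {n} → Permutation′ n → ℕ → Set
FixesInitial w k =
  (∀ i → toℕ i < k → toℕ (w ⟨$⟩ʳ i) < k) ×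
  (∀ j → toℕ j < k → ∃ λ i → toℕ i < k × w ⟨$⟩ʳ i ≡ j)

IsIw : ∀ {n} → Permutation′ n → ℕ → Set
IsIw {n} w k = (1 ≤ k) × (k ≤ n) × FixesInitial w k ×
  (∀ j → 1 ≤ j → j < k → ¬ FixesInitial w j)

-- U_n: there is i > i_w with w(i) ≠ i   (1-based i > k  ⇔  k ≤ toℕ i)
InU : ∀ {n} → Permutation′ n → Set
InU w = ∃ λ k → IsIw w k × ∃ λ i → (k ≤ toℕ i) × (w ⟨$⟩ʳ i ≢ i)

-- Write K for i_w and k for the top card (positions and cards are 0-based).
-- As long as a deck agrees with w from position K on, its top card is below K,
-- because the first K positions of w hold exactly the cards below K.  A homing
-- shuffle only touches positions up to the top card, so all its iterates agree
-- with w from position K on: if w is in U_n, nothing sorts it.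
-- Conversely, if w fixes every position from K on, take the shuffle that homes k
-- and brings to the top the largest card, other than k, lying in positions up to
-- k.  While k + 1 < K, minimality of K puts a card larger than k into one of
-- those positions, so the top card grows and stays below K.  Once k + 1 = K,
-- every position beyond k holds its own card, and the top card then drops by
-- one at each step until the deck is sorted.
module Submission where

open import Defs
open import Data.Nat using (ℕ; suc)
open import Data.Fin.Permutation using (Permutation′)
open import Data.Product using (Σ; _×_)
open import Function.Bundles using (_⇔_)
open import Relation.Nullary using (¬_)

open import Data.Nat as ℕ using (zero; _+_; _∸_; _≤_; _<_; z≤n; s≤s)
open import Data.Nat.Properties
  using (≤-refl; <-irrefl; <-trans; <-≤-trans; ≤-antisym; <⇒≤; <⇒≱; ≮⇒≥; ≰⇒>;
         n<1+n; 1+n≰n; n≤0⇒n≡0; m≤n⇒m<n∨m≡n; ∸-monoʳ-<)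
open import Data.Nat.Induction using (<-wellFounded)
open import Data.Fin as Fin using (Fin; toℕ; fromℕ; fromℕ<; inject≤)
open import Data.Fin.Patterns using (0F)
open import Data.Fin.Properties
  using (_≟_; toℕ-injective; toℕ<n; toℕ-fromℕ; toℕ-fromℕ<; toℕ-inject; toℕ-inject≤;
         inject≤-injective; injective⇒≤; all?; any?; ¬∀⟶∃¬-smallest)
open import Data.Fin.Permutation using (_⟨$⟩ʳ_; _⟨$⟩ˡ_; inverseˡ; inverseʳ; transpose; _∘ₚ_)
import Data.Fin.Permutation.Components as PC
open import Data.Product using (∃; _,_; proj₁; proj₂)
open import Data.Sum using (_⊎_; inj₁; inj₂; [_,_]′)
open import Function.Base using (_∘_; id)
open import Function.Bundles using (Injection; mk⇔)
open import Function.Definitions using (Injective)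
open import Function.Properties.Inverse using (↔⇒↣)
open import Induction.WellFounded using (Acc; acc)
open import Relation.Nullary using (Dec; yes; no; contradiction)
open import Relation.Nullary.Decidable using (¬?; _×-dec_; _→-dec_; decidable-stable)
open import Relation.Unary using (Decidable)
open import Relation.Binary.PropositionalEquality
  using (_≡_; _≢_; refl; sym; trans; cong; cong₂; subst; subst₂)

iter-+ : ∀ {A : Set} (f : A → A) m n x → iter f (m + n) x ≡ iter f m (iter f n x)
iter-+ f zero    n x = refl
iter-+ f (suc m) n x = cong f (iter-+ f m n x)

module _ {A : Set} (f : A → A) (I G : A → Set) (μ : A → ℕ)
         (progress : ∀ a → I a → G a ⊎ (I (f a) × μ (f a) < μ a)) where

  iter-reaches : ∀ a → I a → ∃ λ n → G (iter f n a)
  iter-reaches a = go a (<-wellFounded (μ a))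
    where
    go : ∀ a → Acc _<_ (μ a) → I a → ∃ λ n → G (iter f n a)
    go a (acc smaller) Ia with progress a Ia
    ... | inj₁ Ga = 0 , Ga
    ... | inj₂ (Ifa , decreasing) with go (f a) (smaller decreasing) Ifa
    ...   | n , Gn = n + 1 , subst G (sym (iter-+ f n 1 a)) Gn

Greatest : ∀ {n} → (Fin n → Set) → Fin n → Set
Greatest P i = P i × (∀ j → P j → toℕ j ≤ toℕ i)

greatest? : ∀ {n} {P : Fin n → Set} → Decidable P → ∃ (Greatest P) ⊎ (∀ i → ¬ P i)
greatest? {zero}  P? = inj₂ λ ()
greatest? {suc n} P? with greatest? (P? ∘ Fin.suc)
... | inj₁ (i , Pi , max) = inj₁ (Fin.suc i , Pi , λ { 0F _ → z≤n ; (Fin.suc j) Pj → s≤s (max j Pj) })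
... | inj₂ none with P? 0F
...   | yes P0 = inj₁ (0F , P0 , λ { 0F _ → z≤n ; (Fin.suc j) Pj → contradiction Pj (none j) })
...   | no ¬P0 = inj₂ λ { 0F → ¬P0 ; (Fin.suc j) → none j }

greatest-exists : ∀ {n} {P : Fin n → Set} → Decidable P → ∀ {i} → P i → ∃ (Greatest P)
greatest-exists P? {i} Pi = [ id , (λ none → contradiction Pi (none i)) ]′ (greatest? P?)

Greatest-unique : ∀ {n} {P Q : Fin n → Set} {i j} → (∀ k → P k → Q k) → (∀ k → Q k → P k) →
                  Greatest P i → Greatest Q j → i ≡ j
Greatest-unique P⊆Q Q⊆P (Pi , maxP) (Qj , maxQ) =
  toℕ-injective (≤-antisym (maxQ _ (P⊆Q _ Pi)) (maxP _ (Q⊆P _ Qj)))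

injective-bounded⇒≤ : ∀ {a b N} (f : Fin a → Fin N) → Injective _≡_ _≡_ f →
                      (∀ s → toℕ (f s) < b) → a ≤ b
injective-bounded⇒≤ f f-injective bounded =
  injective⇒≤ {f = λ s → fromℕ< (bounded s)} λ eq → f-injective (toℕ-injective
    (trans (sym (toℕ-fromℕ< (bounded _))) (trans (cong toℕ eq) (toℕ-fromℕ< (bounded _)))))

transpose-matchˡ : ∀ {n} (i j : Fin n) → PC.transpose i j i ≡ j
transpose-matchˡ i j with i ≟ i
... | yes _   = refl
... | no i≢i = contradiction refl i≢i

transpose-matchʳ : ∀ {n} (i j : Fin n) → PC.transpose i j j ≡ i
transpose-matchʳ i j with j ≟ i
... | yes refl = refl
... | no _ with j ≟ j
...   | yes _   = refl
...   | no j≢j = contradiction refl j≢j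

transpose-mismatch : ∀ {n} (i j k : Fin n) → k ≢ i → k ≢ j → PC.transpose i j k ≡ k
transpose-mismatch i j k k≢i k≢j with k ≟ i
... | yes k≡i = contradiction k≡i k≢i
... | no _ with k ≟ j
...   | yes k≡j = contradiction k≡j k≢j
...   | no _    = refl

-- Read as positions: the card at p goes to the top, the top card to position k
-- and the card at k to position p.
cycle : ∀ {n} → Fin (suc n) → Fin (suc n) → Fin (suc n) → Fin (suc n)
cycle k p = PC.transpose k p ∘ PC.transpose 0F k

cycle-zero : ∀ {n} (k p : Fin (suc n)) → cycle k p 0F ≡ p
cycle-zero k p = trans (cong (PC.transpose k p) (transpose-matchˡ 0F k)) (transpose-matchˡ k p)

cycle-home : ∀ {n} (k p : Fin (suc n)) → toℕ p ≤ toℕ k → (p ≡ 0F → k ≡ 0F) → cycle k p k ≡ 0F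
cycle-home k p p≤k p≡0⇒k≡0 =
  trans (cong (PC.transpose k p) (transpose-matchʳ 0F k)) (zero-stays k p≤k p≡0⇒k≡0)
  where
  zero-stays : ∀ k → toℕ p ≤ toℕ k → (p ≡ 0F → k ≡ 0F) → PC.transpose k p 0F ≡ 0F
  zero-stays 0F          p≤0 _ = trans (transpose-matchˡ 0F p) (toℕ-injective (n≤0⇒n≡0 p≤0))
  zero-stays (Fin.suc k) _ p≡0⇒1+k≡0 =
    transpose-mismatch (Fin.suc k) p 0F (λ ()) λ 0≡p → contradiction (p≡0⇒1+k≡0 (sym 0≡p)) λ ()

cycle-beyond : ∀ {n} {k p i : Fin (suc n)} → toℕ p ≤ toℕ k → toℕ k < toℕ i → cycle k p i ≡ i
cycle-beyond {k = k} {p} {i} p≤k k<i =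
  trans (cong (PC.transpose k p) (transpose-mismatch 0F k i i≢0 i≢k)) (transpose-mismatch k p i i≢k i≢p)
  where
  i≢0 : i ≢ 0F
  i≢0 refl = contradiction k<i λ ()
  i≢k : i ≢ k
  i≢k refl = <-irrefl refl k<i
  i≢p : i ≢ p
  i≢p refl = <⇒≱ k<i p≤k

⟨$⟩ʳ-injective : ∀ {n} (π : Permutation′ n) → Injective _≡_ _≡_ (π ⟨$⟩ʳ_)
⟨$⟩ʳ-injective π = Injection.injective (↔⇒↣ π)

⟨$⟩ˡ-cong : ∀ {n} (π ρ : Permutation′ n) → π ≋ ρ → ∀ j → π ⟨$⟩ˡ j ≡ ρ ⟨$⟩ˡ j
⟨$⟩ˡ-cong π ρ π≋ρ j =
  ⟨$⟩ʳ-injective π (trans (inverseʳ π) (trans (sym (inverseʳ ρ)) (sym (π≋ρ (ρ ⟨$⟩ˡ j)))))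

MapsInto : ∀ {n} → Permutation′ n → ℕ → Set
MapsInto w j = ∀ i → toℕ i < j → toℕ (w ⟨$⟩ʳ i) < j

mapsInto⇒fixesInitial : ∀ {n j} (w : Permutation′ n) → j ≤ n → MapsInto w j → FixesInitial w j
mapsInto⇒fixesInitial {n} {j} w j≤n into = into , λ t t<j → w ⟨$⟩ˡ t , preimage< t t<j , inverseʳ w
  where
  inject≤< : ∀ s → toℕ (inject≤ s j≤n) < j
  inject≤< s = subst (_< j) (sym (toℕ-inject≤ s j≤n)) (toℕ<n s)

  preimage< : ∀ t → toℕ t < j → toℕ (w ⟨$⟩ˡ t) < j
  preimage< t t<j with toℕ (w ⟨$⟩ˡ t) ℕ.<? j
  ... | yes p<j = p<j
  ... | no  p≮j =
    contradiction (injective-bounded⇒≤ ((w ⟨$⟩ʳ_) ∘ extend) extend-injective bounded) 1+n≰n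
    where
    -- j + 1 positions that w would all send below j
    extend : Fin (suc j) → Fin n
    extend 0F          = w ⟨$⟩ˡ t
    extend (Fin.suc s) = inject≤ s j≤n

    extend-injective : Injective _≡_ _≡_ ((w ⟨$⟩ʳ_) ∘ extend)
    extend-injective {0F}        {0F}        _  = refl
    extend-injective {0F}        {Fin.suc s} eq =
      contradiction (subst (λ i → toℕ i < j) (sym (⟨$⟩ʳ-injective w eq)) (inject≤< s)) p≮j
    extend-injective {Fin.suc s} {0F}        eq =
      contradiction (subst (λ i → toℕ i < j) (⟨$⟩ʳ-injective w eq) (inject≤< s)) p≮j
    extend-injective {Fin.suc s} {Fin.suc s′} eq =
      cong Fin.suc (inject≤-injective j≤n j≤n s s′ (⟨$⟩ʳ-injective w eq))

    bounded : ∀ s → toℕ (w ⟨$⟩ʳ extend s) < j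
    bounded 0F          = subst (λ i → toℕ i < j) (sym (inverseʳ w)) t<j
    bounded (Fin.suc s) = into _ (inject≤< s)

fixesInitial? : ∀ {n} (w : Permutation′ n) j → Dec (FixesInitial w j)
fixesInitial? w j =
  all? (λ i → (toℕ i ℕ.<? j) →-dec (toℕ (w ⟨$⟩ʳ i) ℕ.<? j)) ×-dec
  all? (λ t → (toℕ t ℕ.<? j) →-dec any? (λ i → (toℕ i ℕ.<? j) ×-dec (w ⟨$⟩ʳ i ≟ t)))

fixesInitial-all : ∀ {n} (w : Permutation′ n) → FixesInitial w n
fixesInitial-all w =
  (λ i _ → toℕ<n (w ⟨$⟩ʳ i)) , λ t _ → w ⟨$⟩ˡ t , toℕ<n (w ⟨$⟩ˡ t) , inverseʳ w

IsIw-exists : ∀ {m} (w : Permutation′ (suc m)) → ∃ (IsIw w)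
IsIw-exists {m} w
  with ¬∀⟶∃¬-smallest (suc m) (λ i → ¬ FixesInitial w (suc (toℕ i))) (λ i → ¬? (fixesInitial? w _))
         (λ noneFixes → noneFixes (fromℕ m)
            (subst (FixesInitial w ∘ suc) (sym (toℕ-fromℕ m)) (fixesInitial-all w)))
... | i , ¬¬fixes , smallerDoNot =
  suc (toℕ i) , s≤s z≤n , toℕ<n i , decidable-stable (fixesInitial? w _) ¬¬fixes , minimal
  where
  minimal : ∀ j → 1 ≤ j → j < suc (toℕ i) → ¬ FixesInitial w j
  minimal (suc j) _ (s≤s j<i) =
    subst (¬_ ∘ FixesInitial w ∘ suc) (trans (toℕ-inject (fromℕ< j<i)) (toℕ-fromℕ< j<i))
          (smallerDoNot (fromℕ< j<i))

IsIw-crossing : ∀ {n} {w : Permutation′ n} {K j} → IsIw w K → 1 ≤ j → j < K →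
                ∃ λ i → toℕ i < j × j ≤ toℕ (w ⟨$⟩ʳ i)
IsIw-crossing {w = w} {K} {j} (_ , K≤n , _ , minimal) 1≤j j<K
  with any? (λ i → (toℕ i ℕ.<? j) ×-dec (j ℕ.≤? toℕ (w ⟨$⟩ʳ i)))
... | yes crossing = crossing
... | no  none     =
  contradiction (mapsInto⇒fixesInitial w (<⇒≤ (<-≤-trans j<K K≤n)) into) (minimal j 1≤j j<K)
  where
  into : MapsInto w j
  into i i<j = ≰⇒> λ j≤wi → none (i , i<j , j≤wi)

IsIw⇒top< : ∀ {n} {w : Permutation′ (suc n)} {K} → IsIw w K → ∀ v →
            (∀ i → K ≤ toℕ i → v ⟨$⟩ʳ i ≡ w ⟨$⟩ʳ i) → toℕ (v ⟨$⟩ʳ 0F) < K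
IsIw⇒top< {w = w} {K} (1≤K , _ , (into , _) , _) v agrees with toℕ (w ⟨$⟩ˡ (v ⟨$⟩ʳ 0F)) ℕ.<? K
... | yes i<K = subst (λ t → toℕ t < K) (inverseʳ w) (into _ i<K)
... | no  i≮K = contradiction (subst (λ t → K ≤ toℕ t) i≡0 (≮⇒≥ i≮K)) (<⇒≱ 1≤K)
  where
  i≡0 : w ⟨$⟩ˡ (v ⟨$⟩ʳ 0F) ≡ 0F
  i≡0 = ⟨$⟩ʳ-injective v (trans (agrees _ (≮⇒≥ i≮K)) (inverseʳ w))

homing-iterates-agree : ∀ {n} {w : Permutation′ (suc n)} {K} → IsIw w K → ∀ F → IsHoming F →
                        ∀ k i → K ≤ toℕ i → iter F k w ⟨$⟩ʳ i ≡ w ⟨$⟩ʳ i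
homing-iterates-agree isIw F homing zero i K≤i = refl
homing-iterates-agree {w = w} {K} isIw F homing@(_ , homes) (suc k) i K≤i =
  trans (proj₂ (homes (iter F k w)) i (<-≤-trans (IsIw⇒top< {w = w} isIw (iter F k w) agrees) K≤i))
        (agrees i K≤i)
  where
  agrees : ∀ i → K ≤ toℕ i → iter F k w ⟨$⟩ʳ i ≡ w ⟨$⟩ʳ i
  agrees = homing-iterates-agree isIw F homing k

Sortable : ∀ {m} → Permutation′ (suc m) → Set
Sortable {m} w = Σ (Permutation′ (suc m) → Permutation′ (suc m)) (λ F → IsHoming F × Sorts F w)

InU⇒¬sortable : ∀ {m} {w : Permutation′ (suc m)} → InU w → ¬ Sortable w
InU⇒¬sortable (K , isIw , i , K≤i , wi≢i) (F , homing , k , sorted) =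
  wi≢i (trans (sym (homing-iterates-agree isIw F homing k i K≤i)) (sorted i))

module _ {m : ℕ} where

  private
    Perm : Set
    Perm = Permutation′ (suc m)

  top : Perm → Fin (suc m)
  top v = v ⟨$⟩ʳ 0F

  Candidate : Perm → Fin (suc m) → Set
  Candidate v y = y ≢ top v × toℕ (v ⟨$⟩ˡ y) ≤ toℕ (top v)

  candidate? : ∀ v → Decidable (Candidate v)
  candidate? v y = ¬? (y ≟ top v) ×-dec (toℕ (v ⟨$⟩ˡ y) ℕ.≤? toℕ (top v))

  candidate-cong : ∀ (π ρ : Perm) → π ≋ ρ → ∀ y → Candidate π y → Candidate ρ y
  candidate-cong π ρ π≋ρ y (y≢top , y≤top) =
    (λ y≡top → y≢top (trans y≡top (sym (π≋ρ 0F)))) ,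
    subst₂ (λ i k → toℕ i ≤ toℕ k) (⟨$⟩ˡ-cong π ρ π≋ρ y) (π≋ρ 0F) y≤top

  candidate-intro : ∀ v y → y ≢ top v → (∀ i → toℕ (top v) < toℕ i → v ⟨$⟩ʳ i ≢ y) →
                    Candidate v y
  candidate-intro v y y≢top notBeyond = y≢top , ≮⇒≥ λ top<i → notBeyond _ top<i (inverseʳ v)

  fixed⇒¬candidate : ∀ v y → toℕ (top v) < toℕ y → v ⟨$⟩ʳ y ≡ y → ¬ Candidate v y
  fixed⇒¬candidate v y top<y vy≡y (_ , y≤top) =
    <⇒≱ top<y (subst (λ i → toℕ i ≤ toℕ (top v)) (trans (cong (v ⟨$⟩ˡ_) (sym vy≡y)) (inverseˡ v))
                     y≤top)

  pivotOf : ∀ v → ∃ (Greatest (Candidate v)) ⊎ (∀ y → ¬ Candidate v y) → Fin (suc m)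
  pivotOf v (inj₁ (x , _)) = v ⟨$⟩ˡ x
  pivotOf v (inj₂ _)       = top v

  pivot : Perm → Fin (suc m)
  pivot v = pivotOf v (greatest? (candidate? v))

  -- _∘ₚ_ composes diagrammatically: shuffle v ⟨$⟩ʳ i is v ⟨$⟩ʳ cycle (top v) (pivot v) i.
  shuffle : Perm → Perm
  shuffle v = (transpose 0F (top v) ∘ₚ transpose (top v) (pivot v)) ∘ₚ v

  pivotOf-≤ : ∀ v r → toℕ (pivotOf v r) ≤ toℕ (top v)
  pivotOf-≤ v (inj₁ (x , (_ , x≤top) , _)) = x≤top
  pivotOf-≤ v (inj₂ _)                      = ≤-refl

  pivotOf-zero : ∀ v r → pivotOf v r ≡ 0F → top v ≡ 0F
  pivotOf-zero v (inj₁ (x , (x≢top , _) , _)) eq =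
    contradiction (trans (sym (inverseʳ v)) (cong (v ⟨$⟩ʳ_) eq)) x≢top
  pivotOf-zero v (inj₂ _)                      eq = eq

  pivotOf-greatest : ∀ v r {x} → Greatest (Candidate v) x → v ⟨$⟩ʳ pivotOf v r ≡ x
  pivotOf-greatest v (inj₁ (x′ , gx′)) gx       =
    trans (inverseʳ v) (Greatest-unique (λ _ → id) (λ _ → id) gx′ gx)
  pivotOf-greatest v (inj₂ none)       (Cx , _) = contradiction Cx (none _)

  pivot-cong : ∀ (π ρ : Perm) → π ≋ ρ → pivot π ≡ pivot ρ
  pivot-cong π ρ π≋ρ = pivotOf-cong (greatest? (candidate? π)) (greatest? (candidate? ρ))
    where
    π⊆ρ : ∀ y → Candidate π y → Candidate ρ y
    π⊆ρ = candidate-cong π ρ π≋ρ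
    ρ⊆π : ∀ y → Candidate ρ y → Candidate π y
    ρ⊆π = candidate-cong ρ π (λ i → sym (π≋ρ i))

    pivotOf-cong : ∀ r s → pivotOf π r ≡ pivotOf ρ s
    pivotOf-cong (inj₁ (x , gx))     (inj₁ (y , gy))     =
      trans (⟨$⟩ˡ-cong π ρ π≋ρ x) (cong (ρ ⟨$⟩ˡ_) (Greatest-unique π⊆ρ ρ⊆π gx gy))
    pivotOf-cong (inj₁ (x , Cx , _)) (inj₂ none)         = contradiction (π⊆ρ x Cx) (none x)
    pivotOf-cong (inj₂ none)         (inj₁ (y , Cy , _)) = contradiction (ρ⊆π y Cy) (none y)
    pivotOf-cong (inj₂ _)            (inj₂ _)            = π≋ρ 0F

  top-shuffle : ∀ v {x} → Greatest (Candidate v) x → top (shuffle v) ≡ x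
  top-shuffle v gx =
    trans (cong (v ⟨$⟩ʳ_) (cycle-zero (top v) (pivot v))) (pivotOf-greatest v (greatest? (candidate? v)) gx)

  shuffle-home : ∀ v → shuffle v ⟨$⟩ʳ top v ≡ top v
  shuffle-home v = cong (v ⟨$⟩ʳ_) (cycle-home (top v) (pivot v) (pivotOf-≤ v r) (pivotOf-zero v r))
    where r = greatest? (candidate? v)

  shuffle-beyond : ∀ v i → toℕ (top v) < toℕ i → shuffle v ⟨$⟩ʳ i ≡ v ⟨$⟩ʳ i
  shuffle-beyond v i top<i = cong (v ⟨$⟩ʳ_) (cycle-beyond (pivotOf-≤ v (greatest? (candidate? v))) top<i)

  shuffle-isHoming : IsHoming shuffle
  shuffle-isHoming = wellDefined , λ v → shuffle-home v , shuffle-beyond v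
    where
    wellDefined : WellDefined shuffle
    wellDefined π ρ π≋ρ i =
      trans (cong₂ (λ k p → π ⟨$⟩ʳ cycle k p i) (π≋ρ 0F) (pivot-cong π ρ π≋ρ)) (π≋ρ _)

  FixedAboveTop : Perm → Set
  FixedAboveTop v = ∀ i → toℕ (top v) < toℕ i → v ⟨$⟩ʳ i ≡ i

  top≡0⇒isIdentity : ∀ v → FixedAboveTop v → toℕ (top v) ≡ 0 → IsIdentity v
  top≡0⇒isIdentity v fixed top≡0 0F          = toℕ-injective top≡0
  top≡0⇒isIdentity v fixed top≡0 (Fin.suc i) =
    fixed (Fin.suc i) (subst (_< suc (toℕ i)) (sym top≡0) (s≤s z≤n))

  descend-step : ∀ v {j} → FixedAboveTop v → toℕ (top v) ≡ suc j →
                 FixedAboveTop (shuffle v) × toℕ (top (shuffle v)) ≡ j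
  descend-step v {j} fixed top≡1+j = fixed′ , top′≡j
    where
    above : ∀ {i} → j < toℕ i → toℕ (top v) < toℕ i ⊎ i ≡ top v
    above j<i with m≤n⇒m<n∨m≡n j<i
    ... | inj₁ 1+j<i = inj₁ (subst (_< _) (sym top≡1+j) 1+j<i)
    ... | inj₂ 1+j≡i = inj₂ (toℕ-injective (trans (sym 1+j≡i) (sym top≡1+j)))

    j<1+m : j < suc m
    j<1+m = <-trans (n<1+n j) (subst (_< suc m) top≡1+j (toℕ<n (top v)))

    y : Fin (suc m)
    y = fromℕ< j<1+m

    y<top : toℕ y < toℕ (top v)
    y<top = subst₂ _<_ (sym (toℕ-fromℕ< j<1+m)) (sym top≡1+j) (n<1+n j)

    y-greatest : Greatest (Candidate v) y
    y-greatest = candidate-intro v y y≢top notBeyond , below-y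
      where
      y≢top : y ≢ top v
      y≢top y≡top = <-irrefl (cong toℕ y≡top) y<top
      notBeyond : ∀ i → toℕ (top v) < toℕ i → v ⟨$⟩ʳ i ≢ y
      notBeyond i top<i vi≡y = <-irrefl (cong toℕ (trans (sym vi≡y) (fixed i top<i))) (<-trans y<top top<i)
      below-y : ∀ z → Candidate v z → toℕ z ≤ toℕ y
      below-y z Cz = ≮⇒≥ λ y<z →
        [ (λ top<z → fixed⇒¬candidate v z top<z (fixed z top<z) Cz) , proj₁ Cz ]′
          (above (subst (_< toℕ z) (toℕ-fromℕ< j<1+m) y<z))

    top′≡j : toℕ (top (shuffle v)) ≡ j
    top′≡j = trans (cong toℕ (top-shuffle v y-greatest)) (toℕ-fromℕ< j<1+m)

    fixed′ : FixedAboveTop (shuffle v)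
    fixed′ i top′<i with above (subst (_< toℕ i) top′≡j top′<i)
    ... | inj₁ top<i  = trans (shuffle-beyond v i top<i) (fixed i top<i)
    ... | inj₂ i≡top = subst (λ t → shuffle v ⟨$⟩ʳ t ≡ t) (sym i≡top) (shuffle-home v)

  descend : ∀ v → FixedAboveTop v →
            IsIdentity v ⊎ (FixedAboveTop (shuffle v) × toℕ (top (shuffle v)) < toℕ (top v))
  descend v fixed = descendFrom (toℕ (top v)) refl
    where
    descendFrom : ∀ k → toℕ (top v) ≡ k →
                  IsIdentity v ⊎ (FixedAboveTop (shuffle v) × toℕ (top (shuffle v)) < toℕ (top v))
    descendFrom zero    top≡0   = inj₁ (top≡0⇒isIdentity v fixed top≡0)
    descendFrom (suc j) top≡1+j with descend-step v fixed top≡1+j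
    ... | fixed′ , top′≡j = inj₂ (fixed′ , subst₂ _<_ (sym top′≡j) (sym top≡1+j) (n<1+n j))

  module _ (w : Perm) {K : ℕ} (isIw : IsIw w K) (fixed : ∀ i → K ≤ toℕ i → w ⟨$⟩ʳ i ≡ i) where

    AgreesAbove : Fin (suc m) → Perm → Set
    AgreesAbove k v = toℕ k < K × (∀ i → toℕ k < toℕ i → v ⟨$⟩ʳ i ≡ w ⟨$⟩ʳ i)

    Tracks : Perm → Set
    Tracks v = AgreesAbove (top v) v

    climb : ∀ v → Tracks v → ∀ {y} → toℕ (top v) < toℕ y → Candidate v y →
            Tracks (shuffle v) × K ∸ toℕ (top (shuffle v)) < K ∸ toℕ (top v)
    climb v (_ , agrees) top<y Cy with greatest-exists (candidate? v) Cy
    ... | x , gx@(Cx , maxCandidate) =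
      subst (λ t → AgreesAbove t (shuffle v) × K ∸ toℕ t < K ∸ toℕ (top v)) (sym (top-shuffle v gx))
        ((x<K , agrees′) , ∸-monoʳ-< top<x (<⇒≤ x<K))
      where
      top<x : toℕ (top v) < toℕ x
      top<x = <-≤-trans top<y (maxCandidate _ Cy)
      x<K : toℕ x < K
      x<K = ≰⇒> λ K≤x → fixed⇒¬candidate v x top<x (trans (agrees x top<x) (fixed x K≤x)) Cx
      agrees′ : ∀ i → toℕ x < toℕ i → shuffle v ⟨$⟩ʳ i ≡ w ⟨$⟩ʳ i
      agrees′ i x<i = trans (shuffle-beyond v i (<-trans top<x x<i)) (agrees i (<-trans top<x x<i))

    ascend : ∀ v → Tracks v →
             FixedAboveTop v ⊎ (Tracks (shuffle v) × K ∸ toℕ (top (shuffle v)) < K ∸ toℕ (top v))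
    ascend v tracks@(top<K , agrees) with m≤n⇒m<n∨m≡n top<K
    ... | inj₂ 1+top≡K =
      inj₁ λ i top<i → trans (agrees i top<i) (fixed i (subst (_≤ toℕ i) 1+top≡K top<i))
    ... | inj₁ 1+top<K with IsIw-crossing {w = w} isIw (s≤s z≤n) 1+top<K
    ...   | i₀ , i₀<1+top , top<wi₀ =
      inj₂ (climb v tracks top<wi₀ (candidate-intro v _ wi₀≢top notBeyond))
      where
      wi₀≢top : w ⟨$⟩ʳ i₀ ≢ top v
      wi₀≢top wi₀≡top = <-irrefl (cong toℕ (sym wi₀≡top)) top<wi₀
      notBeyond : ∀ i → toℕ (top v) < toℕ i → v ⟨$⟩ʳ i ≢ w ⟨$⟩ʳ i₀
      notBeyond i top<i vi≡wi₀ = <⇒≱ top<i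
        (subst (λ t → toℕ t ≤ toℕ (top v)) (⟨$⟩ʳ-injective w (trans (sym vi≡wi₀) (agrees i top<i)))
               (ℕ.s≤s⁻¹ i₀<1+top))

    w-tracks : Tracks w
    w-tracks = IsIw⇒top< {w = w} isIw w (λ _ _ → refl) , λ _ _ → refl

    shuffle-sorts : Sorts shuffle w
    shuffle-sorts with iter-reaches shuffle Tracks FixedAboveTop (λ v → K ∸ toℕ (top v)) ascend w w-tracks
    ... | n₁ , fixed₁ with iter-reaches shuffle FixedAboveTop IsIdentity (toℕ ∘ top) descend _ fixed₁
    ...   | n₂ , sorted = n₂ + n₁ , subst IsIdentity (sym (iter-+ shuffle n₂ n₁ w)) sorted

sortable⊎InU : ∀ {m} (w : Permutation′ (suc m)) → Sortable w ⊎ InU w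
sortable⊎InU w with IsIw-exists w
... | K , isIw with any? (λ i → (K ℕ.≤? toℕ i) ×-dec ¬? (w ⟨$⟩ʳ i ≟ i))
...   | yes (i , K≤i , wi≢i) = inj₂ (K , isIw , i , K≤i , wi≢i)
...   | no  none             = inj₁ (shuffle , shuffle-isHoming , shuffle-sorts w isIw fixed)
  where
  fixed : ∀ i → K ≤ toℕ i → w ⟨$⟩ʳ i ≡ i
  fixed i K≤i = decidable-stable (w ⟨$⟩ʳ i ≟ i) λ wi≢i → none (i , K≤i , wi≢i)

corollary1 : (m : ℕ) (w : Permutation′ (suc m)) →
    (¬ Σ (Permutation′ (suc m) → Permutation′ (suc m)) (λ F → IsHoming F × Sorts F w)) ⇔ InU w
corollary1 m w = mk⇔ ¬sortable⇒InU InU⇒¬sortable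
  where
  ¬sortable⇒InU : ¬ Sortable w → InU w
  ¬sortable⇒InU ¬sortable = [ (λ sortable → contradiction sortable ¬sortable) , id ]′ (sortable⊎InU w)
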